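{- Let $b\ge2$ be an integer and let $n,k$ be positive integers with $b\nmid k$ and $b\nmid n$. Then \[\binom{ -n}{k}^{*}_b+\binom{ -n}{k-1}^{*}_b=\binom{ -n+1}{k}^{*}_b\qquad\text{and}\qquad\binom{ -n}{k}^{**}_b+\binom{ -n}{k-1}^{**}_b=\binom{ -n+1}{k}^{**}_b.\]
   Context: Fix $b\ge2$. For integers $a,j$ with $j\ge0$, $\binom{a}{j}$ denotes the coefficient of $x^j$ in $(1+x)^a$ (expanded as a power series about $0$ when $a<0$), so $\binom{ -a}{j}=(-1)^j\binom{a+j-1}{j}$ for $a>0$ and $\binom{0}{j}=1$ if $j=0$, $0$ if $j>0$; also $\binom{a}{ -1}=0$. For a nonnegative integer $n$ with base-$b$ digits $n_l$ and a nonnegative integer $k$ with base-$b$ digits $k_l$ (so $k=\sum_l k_lb^l$, $0\le k_l\le b-1$), let $N$ be the maximum number of base-$b$ digits of $n$ and $k$, let $S_b(k)=\sum_l k_l$, and define \[\binom{ -n}{k}^{*}_b=\prod_{l=0}^{N-1}\binom{ -n_l}{k_l},\qquad \binom{ -n}{k}^{**}_b=\sum_{\substack{j_0,\dots,j_{N-1}\ge0\\ j_0+\dots+j_{N-1}=S_b(k)}}\prod_{l=0}^{N-1}\binom{ -n_l}{j_l}.\] -}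

module Defs where

open import Data.Nat as ℕ using (ℕ; zero; suc; _⊔_; _∸_; NonZero)
open import Data.Nat.DivMod using (_/_; _%_)
open import Data.Nat.Combinatorics using (_C_)
open import Data.Integer as ℤ using (ℤ; +_; -[1+_]; -_)
open import Data.List using (List; []; _∷_; length)

-- base-b digits of n, least significant first (fuel = n suffices since b ≥ 2);
-- 0 has no digits.
digitsAux : (fuel b : ℕ) → .{{NonZero b}} → ℕ → List ℕ
digitsAux zero    b n       = []
digitsAux (suc f) b zero    = []
digitsAux (suc f) b (suc m) = (suc m % b) ∷ digitsAux f b (suc m / b)

digits : (b : ℕ) → .{{NonZero b}} → ℕ → List ℕ
digits b n = digitsAux n b n

numDigits : (b : ℕ) → .{{NonZero b}} → ℕ → ℕ
numDigits b n = length (digits b n)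

-- l-th base-b digit of n (0 beyond the most significant digit)
nth : List ℕ → ℕ → ℕ
nth []       _       = 0
nth (x ∷ xs) zero    = x
nth (x ∷ xs) (suc l) = nth xs l

digit : (b : ℕ) → .{{NonZero b}} → ℕ → ℕ → ℕ
digit b l n = nth (digits b n) l

sumList : List ℕ → ℕ
sumList []       = 0
sumList (x ∷ xs) = x ℕ.+ sumList xs

digitSum : (b : ℕ) → .{{NonZero b}} → ℕ → ℕ
digitSum b k = sumList (digits b k)

-- generalized binomial coefficient: coefficient of x^j in (1+x)^a
-- for a ≥ 0: a C j ; for a = -(m+1): (-1)^j * C(m+j, j)
sign : ℕ → ℤ
sign zero    = + 1
sign (suc j) = - sign j

binomℤ : ℤ → ℕ → ℤ
binomℤ (+ a)     j = + (a C j)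
binomℤ -[1+ m ]  j = sign j ℤ.* + ((m ℕ.+ j) C j)

maxDigits : (b : ℕ) → .{{NonZero b}} → ℕ → ℕ → ℕ
maxDigits b n k = numDigits b n ⊔ numDigits b k

prodStar : (b : ℕ) → .{{NonZero b}} → (n k : ℕ) → (s N : ℕ) → ℤ
prodStar b n k s zero    = + 1
prodStar b n k s (suc N) =
  binomℤ (- (+ digit b s n)) (digit b s k) ℤ.* prodStar b n k (suc s) N

binomStar : (b : ℕ) → .{{NonZero b}} → ℕ → ℕ → ℤ
binomStar b n k = prodStar b n k 0 (maxDigits b n k)

sumTo : ℕ → (ℕ → ℤ) → ℤ
sumTo zero    f = f 0
sumTo (suc S) f = sumTo S f ℤ.+ f (suc S)

-- Σ_{j_s + … + j_{s+N-1} = S, j_i ≥ 0} ∏_{l=s}^{s+N-1} binom(-n_l, j_l)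
compSum : (b : ℕ) → .{{NonZero b}} → (n : ℕ) → (s N S : ℕ) → ℤ
compSum b n s zero    zero    = + 1
compSum b n s zero    (suc S) = + 0
compSum b n s (suc N) S       =
  sumTo S (λ j → binomℤ (- (+ digit b s n)) j ℤ.* compSum b n (suc s) N (S ∸ j))

binomStarStar : (b : ℕ) → .{{NonZero b}} → ℕ → ℕ → ℤ
binomStarStar b n k = compSum b n 0 (maxDigits b n k) (digitSum b k)

module Submission where

-- Write n = m + 1 and k = j + 1.  Since b ∤ n and b ∤ k, passing from n to m
-- (and from k to j) involves no borrow: n₀ = m₀ + 1, k₀ = j₀ + 1, all higher
-- digits agree, and S_b(k) = S_b(j) + 1.  After padding every product and
-- composition sum with trailing zero digits to one common length, the three
-- terms of each identity share everything above position 0: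
--   * for binom^* the identity reduces to Pascal's rule with negative upper
--     index, binom(-(a+1), c+1) + binom(-(a+1), c) = binom(-a, c+1), at a = m₀, c = j₀;
--   * for binom^** the position-0 factor is convolved with the composition sum
--     over the higher positions, and Pascal's rule passes through the convolution.

open import Defs
open import Data.Nat using (ℕ; _≤_; _∸_; NonZero)
open import Data.Nat.Divisibility using (_∣_)
open import Data.Integer using (_+_)
open import Data.Product using (_×_)
open import Relation.Binary.PropositionalEquality using (_≡_)
open import Relation.Nullary using (¬_)

open import Data.Nat as ℕ using (zero; suc; _<_; s≤s; _⊔_)
import Data.Nat.Properties as ℕP
open import Data.Nat.DivMod
  using (_/_; _%_; m≡m%n+[m/n]*n; m%n<n; m<n⇒m%n≡m; m<n⇒m/n≡0; [m+kn]%n≡m%n;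
         +-distrib-/; m/n<m; m*n%n≡0; 0/n≡0)
open import Data.Nat.Divisibility using (divides)
open import Data.Nat.Combinatorics using (_C_; nCn≡1; nCk+nC[k+1]≡[n+1]C[k+1])
open import Data.Integer as ℤ using (ℤ; +_; -_)
import Data.Integer.Properties as ℤP
open import Data.Integer.Tactic.RingSolver using (solve-∀)
open import Data.List using ([]; _∷_; length)
open import Data.Product using (_,_; proj₁; proj₂)
open import Data.Sum using (inj₁; inj₂)
open import Data.Empty using (⊥-elim)
open import Relation.Binary.PropositionalEquality using (refl; sym; trans; cong; cong₂; subst; module ≡-Reasoning)

binom-zero : ∀ a → binomℤ a 0 ≡ + 1
binom-zero (+ a)      = refl
binom-zero ℤ.-[1+ m ] = cong (λ t → + 1 ℤ.* + (t C 0)) (ℕP.+-identityʳ m)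

-- For a = 0 the right side is binom(0, c+1) = 0; otherwise it is the
-- ordinary Pascal rule for C(a+c, c) after pulling out the common sign.
pascal-neg : ∀ a c →
  binomℤ (- (+ suc a)) (suc c) + binomℤ (- (+ suc a)) c ≡ binomℤ (- (+ a)) (suc c)
pascal-neg zero c rewrite nCn≡1 (suc c) | nCn≡1 c = cancel (sign c)
  where
  cancel : ∀ (s : ℤ) → (- s) ℤ.* + 1 + s ℤ.* + 1 ≡ + 0
  cancel = solve-∀
pascal-neg (suc a) c = begin
    - sign c ℤ.* + ((suc a ℕ.+ suc c) C suc c) + sign c ℤ.* + ((suc a ℕ.+ c) C c)
  ≡⟨ cong (λ t → - sign c ℤ.* t + sign c ℤ.* + ((suc a ℕ.+ c) C c))
          (trans (cong +_ pascal) (ℤP.pos-+ ((suc a ℕ.+ c) C c) ((a ℕ.+ suc c) C suc c))) ⟩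
    - sign c ℤ.* (+ ((suc a ℕ.+ c) C c) + + ((a ℕ.+ suc c) C suc c)) + sign c ℤ.* + ((suc a ℕ.+ c) C c)
  ≡⟨ cancel (sign c) _ _ ⟩
    - sign c ℤ.* + ((a ℕ.+ suc c) C suc c) ∎
  where
  open ≡-Reasoning
  cancel : ∀ (s y z : ℤ) → (- s) ℤ.* (y ℤ.+ z) + s ℤ.* y ≡ (- s) ℤ.* z
  cancel = solve-∀
  pascal : (suc a ℕ.+ suc c) C suc c ≡ (suc a ℕ.+ c) C c ℕ.+ ((a ℕ.+ suc c) C suc c)
  pascal = trans (sym (nCk+nC[k+1]≡[n+1]C[k+1] (a ℕ.+ suc c) c))
                 (cong (λ t → t C c ℕ.+ ((a ℕ.+ suc c) C suc c)) (ℕP.+-suc a c))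

sumTo-ext : ∀ S {F G : ℕ → ℤ} → (∀ j → F j ≡ G j) → sumTo S F ≡ sumTo S G
sumTo-ext zero    h = h 0
sumTo-ext (suc S) h = cong₂ ℤ._+_ (sumTo-ext S h) (h (suc S))

sumTo-shift : ∀ S (F : ℕ → ℤ) → sumTo (suc S) F ≡ F 0 + sumTo S (λ j → F (suc j))
sumTo-shift zero    F = refl
sumTo-shift (suc S) F =
  trans (cong (ℤ._+ F (suc (suc S))) (sumTo-shift S F)) (ℤP.+-assoc (F 0) _ _)

sumTo-+ : ∀ S (F G : ℕ → ℤ) → sumTo S F + sumTo S G ≡ sumTo S (λ j → F j + G j)
sumTo-+ zero    F G = refl
sumTo-+ (suc S) F G =
  trans (interchange (sumTo S F) (F (suc S)) (sumTo S G) (G (suc S)))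
        (cong (ℤ._+ (F (suc S) + G (suc S))) (sumTo-+ S F G))
  where
  interchange : ∀ (a b c d : ℤ) → (a + b) + (c + d) ≡ (a + c) + (b + d)
  interchange = solve-∀

sumTo-delta : ∀ S (G : ℕ → ℤ) → sumTo S (λ j → binomℤ (+ 0) j ℤ.* G j) ≡ G 0
sumTo-delta zero    G = ℤP.*-identityˡ (G 0)
sumTo-delta (suc S) G =
  trans (cong (ℤ._+ (+ 0 ℤ.* G (suc S))) (sumTo-delta S G)) (ℤP.+-identityʳ (G 0))

convolution-pascal : ∀ (f g c : ℕ → ℤ) → g 0 ≡ f 0 → (∀ j → g (suc j) ≡ f (suc j) + f j) →
  ∀ S → sumTo (suc S) (λ j → f j ℤ.* c (suc S ∸ j)) + sumTo S (λ j → f j ℤ.* c (S ∸ j))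
        ≡ sumTo (suc S) (λ j → g j ℤ.* c (suc S ∸ j))
convolution-pascal f g c g₀ gₛ S = begin
    sumTo (suc S) (λ j → f j ℤ.* c (suc S ∸ j)) + sumTo S (λ j → f j ℤ.* c (S ∸ j))
  ≡⟨ cong (_+ sumTo S (λ j → f j ℤ.* c (S ∸ j))) (sumTo-shift S (λ j → f j ℤ.* c (suc S ∸ j))) ⟩
    (f 0 ℤ.* c (suc S) + sumTo S (λ j → f (suc j) ℤ.* c (S ∸ j))) + sumTo S (λ j → f j ℤ.* c (S ∸ j))
  ≡⟨ ℤP.+-assoc (f 0 ℤ.* c (suc S)) _ _ ⟩
    f 0 ℤ.* c (suc S) + (sumTo S (λ j → f (suc j) ℤ.* c (S ∸ j)) + sumTo S (λ j → f j ℤ.* c (S ∸ j)))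
  ≡⟨ cong₂ _+_ (cong (ℤ._* c (suc S)) (sym g₀)) (trans (sumTo-+ S _ _) (sumTo-ext S merge)) ⟩
    g 0 ℤ.* c (suc S) + sumTo S (λ j → g (suc j) ℤ.* c (S ∸ j))
  ≡⟨ sym (sumTo-shift S (λ j → g j ℤ.* c (suc S ∸ j))) ⟩
    sumTo (suc S) (λ j → g j ℤ.* c (suc S ∸ j)) ∎
  where
  open ≡-Reasoning
  merge : ∀ j → f (suc j) ℤ.* c (S ∸ j) + f j ℤ.* c (S ∸ j) ≡ g (suc j) ℤ.* c (S ∸ j)
  merge j = trans (sym (ℤP.*-distribʳ-+ (c (S ∸ j)) (f (suc j)) (f j)))
                  (cong (ℤ._* c (S ∸ j)) (sym (gₛ j)))

module DigitPredicates (b : ℕ) .{{_ : NonZero b}} where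

  VanishFrom : ℕ → ℕ → Set
  VanishFrom s x = ∀ l → s ≤ l → digit b l x ≡ 0

  AgreeFrom : ℕ → ℕ → ℕ → Set
  AgreeFrom s x x' = ∀ l → s ≤ l → digit b l x ≡ digit b l x'

  vanish-tail : ∀ {s} x → VanishFrom s x → VanishFrom (suc s) x
  vanish-tail _ v l p = v l (ℕP.≤-trans (ℕP.n≤1+n _) p)

  agree-tail : ∀ {s} x x' → AgreeFrom s x x' → AgreeFrom (suc s) x x'
  agree-tail _ _ a l p = a l (ℕP.≤-trans (ℕP.n≤1+n _) p)

  vanish-beyond : ∀ {s} x → numDigits b x ≤ s → VanishFrom s x
  vanish-beyond x = go (digits b x)
    where
    go : ∀ {s} xs → length xs ≤ s → ∀ l → s ≤ l → nth xs l ≡ 0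
    go []       _       l       _       = refl
    go (_ ∷ xs) (s≤s p) (suc l) (s≤s q) = go xs p l q

  vanish-beyond-max : ∀ {s} x y → maxDigits b x y ≤ s → VanishFrom s x × VanishFrom s y
  vanish-beyond-max x y p =
      vanish-beyond x (ℕP.≤-trans (ℕP.m≤m⊔n (numDigits b x) (numDigits b y)) p)
    , vanish-beyond y (ℕP.≤-trans (ℕP.m≤n⊔m (numDigits b x) (numDigits b y)) p)

module Digits (b : ℕ) .{{_ : NonZero b}} (b≥2 : 2 ≤ b) where
  open DigitPredicates b

  private
    div-decreases : ∀ x → suc x / b ≤ x
    div-decreases x = ℕP.<⇒≤pred (m/n<m (suc x) b b≥2)

    fuel-irrelevant : ∀ f g x → x ≤ f → x ≤ g → digitsAux f b x ≡ digitsAux g b x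
    fuel-irrelevant zero    zero    x       _       _       = refl
    fuel-irrelevant zero    (suc g) zero    _       _       = refl
    fuel-irrelevant (suc f) zero    zero    _       _       = refl
    fuel-irrelevant (suc f) (suc g) zero    _       _       = refl
    fuel-irrelevant (suc f) (suc g) (suc x) (s≤s p) (s≤s q) =
      cong (suc x % b ∷_) (fuel-irrelevant f g (suc x / b)
        (ℕP.≤-trans (div-decreases x) p) (ℕP.≤-trans (div-decreases x) q))

    digits-suc : ∀ x → digits b (suc x) ≡ (suc x % b) ∷ digits b (suc x / b)
    digits-suc x =
      cong (suc x % b ∷_) (fuel-irrelevant x (suc x / b) (suc x / b) (div-decreases x) ℕP.≤-refl)

  digit-zero : ∀ x → digit b 0 x ≡ x % b
  digit-zero zero    = sym (m*n%n≡0 0 b)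
  digit-zero (suc x) = cong (λ xs → nth xs 0) (digits-suc x)

  digit-suc : ∀ l x → digit b (suc l) x ≡ digit b l (x / b)
  digit-suc l zero    = cong (digit b l) (sym (0/n≡0 b))
  digit-suc l (suc x) = cong (λ xs → nth xs (suc l)) (digits-suc x)

  digitSum-unfold : ∀ x → digitSum b x ≡ x % b ℕ.+ digitSum b (x / b)
  digitSum-unfold zero    = sym (cong₂ ℕ._+_ (m*n%n≡0 0 b) (cong (digitSum b) (0/n≡0 b)))
  digitSum-unfold (suc x) = cong sumList (digits-suc x)

  no-carry : ∀ x → ¬ (b ∣ suc x) → suc x % b ≡ suc (x % b) × suc x / b ≡ x / b
  no-carry x b∤x+1 = last-digit , quotient
    where
    open ≡-Reasoning
    r = x % b
    q = x / b
    x≡r+qb : x ≡ r ℕ.+ q ℕ.* b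
    x≡r+qb = m≡m%n+[m/n]*n x b
    r+1<b : suc r < b
    r+1<b with ℕP.m≤n⇒m<n∨m≡n (m%n<n x b)
    ... | inj₁ r+1<b  = r+1<b
    ... | inj₂ r+1≡b  = ⊥-elim (b∤x+1 (divides (suc q) (begin
          suc x            ≡⟨ cong suc x≡r+qb ⟩
          suc r ℕ.+ q ℕ.* b ≡⟨ cong (ℕ._+ q ℕ.* b) r+1≡b ⟩
          b ℕ.+ q ℕ.* b     ∎)))
    last-digit : suc x % b ≡ suc r
    last-digit = begin
      suc x % b             ≡⟨ cong (λ t → suc t % b) x≡r+qb ⟩
      (suc r ℕ.+ q ℕ.* b) % b ≡⟨ [m+kn]%n≡m%n (suc r) q b ⟩
      suc r % b             ≡⟨ m<n⇒m%n≡m r+1<b ⟩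
      suc r                 ∎
    1%b≡1 : 1 % b ≡ 1
    1%b≡1 = m<n⇒m%n≡m b≥2
    quotient : suc x / b ≡ q
    quotient = begin
      suc x / b     ≡⟨ cong (_/ b) (ℕP.+-comm 1 x) ⟩
      (x ℕ.+ 1) / b ≡⟨ +-distrib-/ x 1 (subst (λ t → r ℕ.+ t < b) (sym 1%b≡1)
                                          (subst (_< b) (ℕP.+-comm 1 r) r+1<b)) ⟩
      q ℕ.+ 1 / b   ≡⟨ cong (q ℕ.+_) (m<n⇒m/n≡0 b≥2) ⟩
      q ℕ.+ 0       ≡⟨ ℕP.+-identityʳ q ⟩
      q             ∎

  agree-pred : ∀ x → ¬ (b ∣ suc x) → AgreeFrom 1 x (suc x)
  agree-pred x b∤x+1 (suc l) _ = begin
    digit b (suc l) x       ≡⟨ digit-suc l x ⟩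
    digit b l (x / b)       ≡⟨ cong (digit b l) (sym (proj₂ (no-carry x b∤x+1))) ⟩
    digit b l (suc x / b)   ≡⟨ sym (digit-suc l (suc x)) ⟩
    digit b (suc l) (suc x) ∎
    where open ≡-Reasoning

  digitSum-pred : ∀ x → ¬ (b ∣ suc x) → digitSum b (suc x) ≡ suc (digitSum b x)
  digitSum-pred x b∤x+1 = begin
    digitSum b (suc x)                         ≡⟨ digitSum-unfold (suc x) ⟩
    suc x % b ℕ.+ digitSum b (suc x / b)       ≡⟨ cong₂ (λ u v → u ℕ.+ digitSum b v) last quot ⟩
    suc (x % b ℕ.+ digitSum b (x / b))         ≡⟨ cong suc (sym (digitSum-unfold x)) ⟩
    suc (digitSum b x)                         ∎
    where
    open ≡-Reasoning
    last = proj₁ (no-carry x b∤x+1)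
    quot = proj₂ (no-carry x b∤x+1)

module Products (b : ℕ) .{{_ : NonZero b}} where
  open DigitPredicates b

  private
    -- Factors at positions where both digits vanish equal binom(0,0) = 1.
    prodStar-trivial : ∀ x y s T → VanishFrom s x → VanishFrom s y → prodStar b x y s T ≡ + 1
    prodStar-trivial x y s zero    vx vy = refl
    prodStar-trivial x y s (suc T) vx vy
      rewrite vx s ℕP.≤-refl | vy s ℕP.≤-refl =
        trans (ℤP.*-identityˡ _) (prodStar-trivial x y (suc s) T (vanish-tail x vx) (vanish-tail y vy))

  prodStar-pad : ∀ x y s N T → N ≤ T → VanishFrom (s ℕ.+ N) x → VanishFrom (s ℕ.+ N) y →
                 prodStar b x y s N ≡ prodStar b x y s T
  prodStar-pad x y s zero T _ vx vy rewrite ℕP.+-identityʳ s =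
    sym (prodStar-trivial x y s T vx vy)
  prodStar-pad x y s (suc N) (suc T) (s≤s p) vx vy rewrite ℕP.+-suc s N =
    cong (binomℤ (- (+ digit b s x)) (digit b s y) ℤ.*_) (prodStar-pad x y (suc s) N T p vx vy)

  prodStar-cong : ∀ x y x' y' s N → AgreeFrom s x x' → AgreeFrom s y y' →
                  prodStar b x y s N ≡ prodStar b x' y' s N
  prodStar-cong x y x' y' s zero    ax ay = refl
  prodStar-cong x y x' y' s (suc N) ax ay = cong₂ ℤ._*_
    (cong₂ (λ u v → binomℤ (- (+ u)) v) (ax s ℕP.≤-refl) (ay s ℕP.≤-refl))
    (prodStar-cong x y x' y' (suc s) N (agree-tail x x' ax) (agree-tail y y' ay))

  private
    compSum-empty : ∀ x x' s s' S → compSum b x s 0 S ≡ compSum b x' s' 0 S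
    compSum-empty x x' s s' zero    = refl
    compSum-empty x x' s s' (suc S) = refl

    -- A part indexed by a zero digit contributes binom(0, j) = [j = 0].
    compSum-trivial : ∀ x s T S → VanishFrom s x → compSum b x s T S ≡ compSum b x s 0 S
    compSum-trivial x s zero    S vx = refl
    compSum-trivial x s (suc T) S vx = begin
        sumTo S (λ j → binomℤ (- (+ digit b s x)) j ℤ.* compSum b x (suc s) T (S ∸ j))
      ≡⟨ sumTo-ext S (λ j → cong (λ d → binomℤ (- (+ d)) j ℤ.* compSum b x (suc s) T (S ∸ j))
                                 (vx s ℕP.≤-refl)) ⟩
        sumTo S (λ j → binomℤ (+ 0) j ℤ.* compSum b x (suc s) T (S ∸ j))
      ≡⟨ sumTo-delta S (λ j → compSum b x (suc s) T (S ∸ j)) ⟩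
        compSum b x (suc s) T S
      ≡⟨ compSum-trivial x (suc s) T S (vanish-tail x vx) ⟩
        compSum b x (suc s) 0 S
      ≡⟨ compSum-empty x x (suc s) s S ⟩
        compSum b x s 0 S ∎
      where open ≡-Reasoning

  compSum-pad : ∀ x s N T S → N ≤ T → VanishFrom (s ℕ.+ N) x →
                compSum b x s N S ≡ compSum b x s T S
  compSum-pad x s zero T S _ vx rewrite ℕP.+-identityʳ s =
    sym (compSum-trivial x s T S vx)
  compSum-pad x s (suc N) (suc T) S (s≤s p) vx rewrite ℕP.+-suc s N =
    sumTo-ext S (λ j → cong (binomℤ (- (+ digit b s x)) j ℤ.*_)
                            (compSum-pad x (suc s) N T (S ∸ j) p vx))

  compSum-cong : ∀ x x' s N S → AgreeFrom s x x' → compSum b x s N S ≡ compSum b x' s N S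
  compSum-cong x x' s zero    S ax = compSum-empty x x' s s S
  compSum-cong x x' s (suc N) S ax = sumTo-ext S (λ j → cong₂ ℤ._*_
    (cong (λ d → binomℤ (- (+ d)) j) (ax s ℕP.≤-refl))
    (compSum-cong x x' (suc s) N (S ∸ j) (agree-tail x x' ax)))

module Head (b : ℕ) .{{_ : NonZero b}} (b≥2 : 2 ≤ b) where
  open DigitPredicates b
  open Digits b b≥2
  open Products b

  binomStar-head : ∀ x y T → maxDigits b x y ≤ suc T →
    binomStar b x y ≡ binomℤ (- (+ (x % b))) (y % b) ℤ.* prodStar b x y 1 T
  binomStar-head x y T bound =
    trans (prodStar-pad x y 0 (maxDigits b x y) (suc T) bound vx vy)
          (cong₂ (λ u v → binomℤ (- (+ u)) v ℤ.* prodStar b x y 1 T) (digit-zero x) (digit-zero y))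
    where
    vx = proj₁ (vanish-beyond-max x y ℕP.≤-refl)
    vy = proj₂ (vanish-beyond-max x y ℕP.≤-refl)

  binomStarStar-head : ∀ x y T → maxDigits b x y ≤ suc T →
    binomStarStar b x y ≡
      sumTo (digitSum b y) (λ i → binomℤ (- (+ (x % b))) i ℤ.* compSum b x 1 T (digitSum b y ∸ i))
  binomStarStar-head x y T bound =
    trans (compSum-pad x 0 (maxDigits b x y) (suc T) (digitSum b y) bound
                       (proj₁ (vanish-beyond-max x y ℕP.≤-refl)))
          (sumTo-ext (digitSum b y) (λ i →
             cong (λ d → binomℤ (- (+ d)) i ℤ.* compSum b x 1 T (digitSum b y ∸ i)) (digit-zero x)))

module DigitwisePascal (b : ℕ) .{{_ : NonZero b}} (b≥2 : 2 ≤ b)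
                       (m j : ℕ) (b∤n : ¬ (b ∣ suc m)) (b∤k : ¬ (b ∣ suc j)) where
  open Digits b b≥2
  open Products b
  open Head b b≥2
  open ≡-Reasoning

  private
    n = suc m
    k = suc j

    -- a common padding length for all the (upper, lower) pairs involved
    Dnk = maxDigits b n k
    Dnj = maxDigits b n j
    Dmk = maxDigits b m k
    T = Dnk ⊔ Dnj ⊔ Dmk

    Dnk≤sucT : Dnk ≤ suc T
    Dnk≤sucT = ℕP.m≤n⇒m≤1+n (ℕP.m≤n⇒m≤n⊔o Dmk (ℕP.m≤m⊔n Dnk Dnj))
    Dnj≤sucT : Dnj ≤ suc T
    Dnj≤sucT = ℕP.m≤n⇒m≤1+n (ℕP.m≤n⇒m≤n⊔o Dmk (ℕP.m≤n⊔m Dnk Dnj))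
    Dmk≤sucT : Dmk ≤ suc T
    Dmk≤sucT = ℕP.m≤n⇒m≤1+n (ℕP.m≤n⊔m (Dnk ⊔ Dnj) Dmk)

    n₀ : n % b ≡ suc (m % b)
    n₀ = proj₁ (no-carry m b∤n)
    k₀ : k % b ≡ suc (j % b)
    k₀ = proj₁ (no-carry j b∤k)

    f g : ℕ → ℤ
    f i = binomℤ (- (+ suc (m % b))) i
    g i = binomℤ (- (+ (m % b))) i

  -- Factor out the common tail product Q and apply pascal-neg at position 0.
  binomStar-pascal : binomStar b n k + binomStar b n j ≡ binomStar b m k
  binomStar-pascal = begin
      binomStar b n k + binomStar b n j
    ≡⟨ cong₂ _+_ (binomStar-head n k T Dnk≤sucT) (binomStar-head n j T Dnj≤sucT) ⟩
      binomℤ (- (+ (n % b))) (k % b) ℤ.* Q + binomℤ (- (+ (n % b))) (j % b) ℤ.* prodStar b n j 1 T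
    ≡⟨ cong₂ (λ u v → binomℤ (- (+ u)) v ℤ.* Q + binomℤ (- (+ u)) (j % b) ℤ.* prodStar b n j 1 T) n₀ k₀ ⟩
      f (suc (j % b)) ℤ.* Q + f (j % b) ℤ.* prodStar b n j 1 T
    ≡⟨ cong (λ t → f (suc (j % b)) ℤ.* Q + f (j % b) ℤ.* t)
            (prodStar-cong n j n k 1 T (λ _ _ → refl) (agree-pred j b∤k)) ⟩
      f (suc (j % b)) ℤ.* Q + f (j % b) ℤ.* Q
    ≡⟨ sym (ℤP.*-distribʳ-+ Q (f (suc (j % b))) (f (j % b))) ⟩
      (f (suc (j % b)) + f (j % b)) ℤ.* Q
    ≡⟨ cong (ℤ._* Q) (pascal-neg (m % b) (j % b)) ⟩
      g (suc (j % b)) ℤ.* Q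
    ≡⟨ cong (λ t → g (suc (j % b)) ℤ.* t) (prodStar-cong n k m k 1 T (λ l p → sym (agree-pred m b∤n l p)) (λ _ _ → refl)) ⟩
      g (suc (j % b)) ℤ.* prodStar b m k 1 T
    ≡⟨ cong (λ v → g v ℤ.* prodStar b m k 1 T) (sym k₀) ⟩
      binomℤ (- (+ (m % b))) (k % b) ℤ.* prodStar b m k 1 T
    ≡⟨ sym (binomStar-head m k T Dmk≤sucT) ⟩
      binomStar b m k ∎
    where
    Q = prodStar b n k 1 T

  -- Write all three terms as convolutions of a position-0 binomial with the
  -- common tail sum R, then apply convolution-pascal.
  binomStarStar-pascal : binomStarStar b n k + binomStarStar b n j ≡ binomStarStar b m k
  binomStarStar-pascal = begin
      binomStarStar b n k + binomStarStar b n j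
    ≡⟨ cong₂ _+_ nk nj ⟩
      sumTo (suc S) (λ i → f i ℤ.* R (suc S ∸ i)) + sumTo S (λ i → f i ℤ.* R (S ∸ i))
    ≡⟨ convolution-pascal f g R (trans (binom-zero (- (+ (m % b)))) (sym (binom-zero (- (+ suc (m % b))))))
                          (λ i → sym (pascal-neg (m % b) i)) S ⟩
      sumTo (suc S) (λ i → g i ℤ.* R (suc S ∸ i))
    ≡⟨ sym mk ⟩
      binomStarStar b m k ∎
    where
    S = digitSum b j
    R = compSum b n 1 T
    Sk : digitSum b k ≡ suc S
    Sk = digitSum-pred j b∤k
    nk : binomStarStar b n k ≡ sumTo (suc S) (λ i → f i ℤ.* R (suc S ∸ i))
    nk = trans (binomStarStar-head n k T Dnk≤sucT)
      (cong (λ (u , s) → sumTo s (λ i → binomℤ (- (+ u)) i ℤ.* R (s ∸ i))) (cong₂ _,_ n₀ Sk))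
    nj : binomStarStar b n j ≡ sumTo S (λ i → f i ℤ.* R (S ∸ i))
    nj = trans (binomStarStar-head n j T Dnj≤sucT)
      (cong (λ u → sumTo S (λ i → binomℤ (- (+ u)) i ℤ.* R (S ∸ i))) n₀)
    mk : binomStarStar b m k ≡ sumTo (suc S) (λ i → g i ℤ.* R (suc S ∸ i))
    mk = trans (binomStarStar-head m k T Dmk≤sucT)
      (trans (cong (λ s → sumTo s (λ i → g i ℤ.* compSum b m 1 T (s ∸ i))) Sk)
             (sumTo-ext (suc S) (λ i → cong (g i ℤ.*_)
                (compSum-cong m n 1 T (suc S ∸ i) (agree-pred m b∤n)))))

proposition4p1 : (b : ℕ) → .{{_ : NonZero b}} → 2 ≤ b →
    (n k : ℕ) → 1 ≤ n → 1 ≤ k → ¬ (b ∣ k) → ¬ (b ∣ n) →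
    (binomStar b n k + binomStar b n (k ∸ 1) ≡ binomStar b (n ∸ 1) k)
    × (binomStarStar b n k + binomStarStar b n (k ∸ 1) ≡ binomStarStar b (n ∸ 1) k)
proposition4p1 b b≥2 (suc m) (suc j) _ _ b∤k b∤n =
  binomStar-pascal , binomStarStar-pascal
  where open DigitwisePascal b b≥2 m j b∤n b∤k
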